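{- For all integers $n$ and $d$ with $1\le d\le n-1$, \[ \chi_2(n) \le \chi_2(d) + \chi_2(n+1-d) - 1. \]
   Context: For $m\ge 1$, $\chi_2(m)$ denotes the minimum number of colors needed to color the nonzero vectors of $\mathbb{F}_2^m$ (the points of $\mathrm{PG}(m-1,2)$) so that no triple $\{x,y,x+y\}$ with $x\ne y$ nonzero (a line of $\mathrm{PG}(m-1,2)$) is monochromatic. (In particular $\chi_2(1)=1$.) -}

module Defs where

open import Data.Nat using (ℕ; _≤_)
open import Data.Bool using (Bool; false; _xor_)
open import Data.Vec using (Vec; replicate; zipWith)
open import Data.Fin using (Fin)
open import Data.Product using (_×_; Σ)
open import Relation.Binary.PropositionalEquality using (_≡_)
open import Relation.Nullary using (¬_)

F₂^ : ℕ → Set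
F₂^ m = Vec Bool m

_⊕_ : ∀ {m} → F₂^ m → F₂^ m → F₂^ m
_⊕_ = zipWith _xor_

𝟎 : ∀ {m} → F₂^ m
𝟎 {m} = replicate m false

NonZero₂ : ∀ {m} → F₂^ m → Set
NonZero₂ x = ¬ (x ≡ 𝟎)

-- A k-coloring of the nonzero vectors (value on 0 is irrelevant) with no
-- monochromatic triple {x, y, x+y}, x ≠ y both nonzero.
ProperColoring : (m k : ℕ) → (F₂^ m → Fin k) → Set
ProperColoring m k c =
  ∀ (x y : F₂^ m) → NonZero₂ x → NonZero₂ y → ¬ (x ≡ y) →
  ¬ ((c x ≡ c y) × (c y ≡ c (x ⊕ y)))

Colorable : ℕ → ℕ → Set
Colorable m k = Σ (F₂^ m → Fin k) (ProperColoring m k)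

IsChi₂ : ℕ → ℕ → Set
IsChi₂ m k = Colorable m k × (∀ k' → Colorable m k' → k ≤ k')

{-# OPTIONS --safe #-}
-- Split F₂^(d+e) as F₂^d × F₂^e. Take a proper colouring f of F₂^d with b + 1
-- colours, normalised so that 0 gets colour zero, and a proper colouring g of
-- F₂^(1+e) with c colours. Colour (x , y) by f x when f x ≠ zero, and otherwise
-- by g ([x ≠ 0] , y). A monochromatic line of the first kind would be one of f.
-- On a colour class of f the indicator x ↦ [x ≠ 0] is additive, because the
-- class contains no line; so (x , y) ↦ ([x ≠ 0] , y) maps a monochromatic line
-- of the second kind to one of g.
module Submission where

open import Defs
open import Data.Nat as ℕ using (ℕ; _+_; _∸_; _≤_; _<_)
open import Data.Nat.Properties using (+-comm; +-∸-comm; +-monoˡ-≤; m+[n∸m]≡n; <⇒≤)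
open import Data.Bool using (Bool; true; false; not; _xor_; if_then_else_)
open import Data.Bool.Properties using (xor-same; xor-assoc; xor-identityˡ; xor-identityʳ)
  renaming (_≟_ to _≟ᴮ_)
open import Data.Vec using ([]; _∷_; _++_; take; drop; head; tail)
open import Data.Vec.Properties
  using (≡-dec; zipWith-assoc; zipWith-identityˡ; zipWith-identityʳ; take-zipWith; drop-zipWith; take++drop≡id)
open import Data.Fin using (Fin; zero; suc; join; splitAt)
open import Data.Fin.Properties using (splitAt-join)
open import Data.Sum using (_⊎_; inj₁; inj₂)
open import Data.Product using (_×_; _,_; ∃-syntax)
open import Data.Empty using (⊥-elim)
open import Function using (_∘_)
open import Relation.Nullary using (¬_; Dec; does)
open import Relation.Nullary.Decidable using (dec-true; dec-false; decidable-stable; toSum)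
open import Relation.Binary.PropositionalEquality
  using (_≡_; _≢_; refl; sym; trans; cong; cong₂; subst; module ≡-Reasoning)
open ≡-Reasoning

private variable
  m k b c : ℕ
  A : Set
  x y : F₂^ m

⊕-assoc : (x y z : F₂^ m) → (x ⊕ y) ⊕ z ≡ x ⊕ (y ⊕ z)
⊕-assoc = zipWith-assoc xor-assoc

⊕-identityˡ : (x : F₂^ m) → 𝟎 ⊕ x ≡ x
⊕-identityˡ = zipWith-identityˡ xor-identityˡ

⊕-identityʳ : (x : F₂^ m) → x ⊕ 𝟎 ≡ x
⊕-identityʳ = zipWith-identityʳ xor-identityʳ

⊕-self : (x : F₂^ m) → x ⊕ x ≡ 𝟎
⊕-self []      = refl
⊕-self (a ∷ x) = cong₂ _∷_ (xor-same a) (⊕-self x)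

⊕≡𝟎⇒≡ : (x y : F₂^ m) → x ⊕ y ≡ 𝟎 → x ≡ y
⊕≡𝟎⇒≡ x y x⊕y≡𝟎 = begin
  x            ≡⟨ ⊕-identityʳ x ⟨
  x ⊕ 𝟎        ≡⟨ cong (x ⊕_) (⊕-self y) ⟨
  x ⊕ (y ⊕ y)  ≡⟨ ⊕-assoc x y y ⟨
  (x ⊕ y) ⊕ y  ≡⟨ cong (_⊕ y) x⊕y≡𝟎 ⟩
  𝟎 ⊕ y        ≡⟨ ⊕-identityˡ y ⟩
  y            ∎

_≟𝟎 : (x : F₂^ m) → Dec (x ≡ 𝟎)
x ≟𝟎 = ≡-dec _≟ᴮ_ x 𝟎

nonZeroᵇ : F₂^ m → Bool
nonZeroᵇ x = not (does (x ≟𝟎))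

nonZeroᵇ-𝟎 : nonZeroᵇ (𝟎 {m}) ≡ false
nonZeroᵇ-𝟎 {m} = cong not (dec-true (𝟎 {m} ≟𝟎) refl)

nonZeroᵇ-≢𝟎 : NonZero₂ x → nonZeroᵇ x ≡ true
nonZeroᵇ-≢𝟎 {x = x} x≢𝟎 = cong not (dec-false (x ≟𝟎) x≢𝟎)

Line : F₂^ m → F₂^ m → Set
Line x y = NonZero₂ x × NonZero₂ y × NonZero₂ (x ⊕ y)

Monochromatic : (F₂^ m → A) → F₂^ m → F₂^ m → Set
Monochromatic col x y = col x ≡ col y × col y ≡ col (x ⊕ y)

LineFree : (F₂^ m → A) → Set
LineFree col = ∀ x y → Line x y → ¬ Monochromatic col x y

proper⇒lineFree : {col : F₂^ m → Fin k} → ProperColoring m k col → LineFree col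
proper⇒lineFree proper x y (x≢𝟎 , y≢𝟎 , x⊕y≢𝟎) =
  proper x y x≢𝟎 y≢𝟎 λ { refl → x⊕y≢𝟎 (⊕-self x) }

lineFree⇒proper : {col : F₂^ m → Fin k} → LineFree col → ProperColoring m k col
lineFree⇒proper free x y x≢𝟎 y≢𝟎 x≢y = free x y (x≢𝟎 , y≢𝟎 , x≢y ∘ ⊕≡𝟎⇒≡ x y)

lineFree-∘ : {B : Set} {h : A → B} {col : F₂^ m → A} →
             (∀ {s t} → h s ≡ h t → s ≡ t) → LineFree col → LineFree (h ∘ col)
lineFree-∘ h-injective free x y line (e₁ , e₂) = free x y line (h-injective e₁ , h-injective e₂)

¬colorable-0 : ¬ Colorable m 0
¬colorable-0 (col , _) with col 𝟎
... | ()

colorable⇒lineFree-with-𝟎 : Colorable m k → (i : Fin k) →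
                            ∃[ col ] LineFree col × col 𝟎 ≡ i
colorable⇒lineFree-with-𝟎 {m = m} {k = k} (col , proper) i = recoloured , recoloured-lineFree , recoloured-𝟎
  where
  recoloured : F₂^ m → Fin k
  recoloured x = if nonZeroᵇ x then col x else i

  recoloured-𝟎 : recoloured 𝟎 ≡ i
  recoloured-𝟎 = cong (λ t → if t then col 𝟎 else i) (nonZeroᵇ-𝟎 {m})

  recoloured-≢𝟎 : NonZero₂ x → recoloured x ≡ col x
  recoloured-≢𝟎 {x = x} x≢𝟎 = cong (λ t → if t then col x else i) (nonZeroᵇ-≢𝟎 x≢𝟎)

  recoloured-lineFree : LineFree recoloured
  recoloured-lineFree x y line@(x≢𝟎 , y≢𝟎 , x⊕y≢𝟎) (e₁ , e₂) =
    proper⇒lineFree proper x y line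
      ( trans (sym (recoloured-≢𝟎 x≢𝟎)) (trans e₁ (recoloured-≢𝟎 y≢𝟎))
      , trans (sym (recoloured-≢𝟎 y≢𝟎)) (trans e₂ (recoloured-≢𝟎 x⊕y≢𝟎)) )

nonZeroᵇ-⊕ : ∀ {m} {x y : F₂^ m} {col : F₂^ m → A} → LineFree col → Monochromatic col x y →
             nonZeroᵇ (x ⊕ y) ≡ nonZeroᵇ x xor nonZeroᵇ y
nonZeroᵇ-⊕ {m = m} {x = x} {y = y} free mono with toSum (x ≟𝟎) | toSum (y ≟𝟎)
... | inj₁ refl | _ = begin
  nonZeroᵇ (𝟎 ⊕ y)                 ≡⟨ cong nonZeroᵇ (⊕-identityˡ y) ⟩
  nonZeroᵇ y                       ≡⟨ cong (_xor nonZeroᵇ y) (nonZeroᵇ-𝟎 {m}) ⟨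
  nonZeroᵇ (𝟎 {m}) xor nonZeroᵇ y  ∎
... | inj₂ _ | inj₁ refl = begin
  nonZeroᵇ (x ⊕ 𝟎)                 ≡⟨ cong nonZeroᵇ (⊕-identityʳ x) ⟩
  nonZeroᵇ x                       ≡⟨ xor-identityʳ (nonZeroᵇ x) ⟨
  nonZeroᵇ x xor false             ≡⟨ cong (nonZeroᵇ x xor_) (nonZeroᵇ-𝟎 {m}) ⟨
  nonZeroᵇ x xor nonZeroᵇ (𝟎 {m})  ∎
... | inj₂ x≢𝟎 | inj₂ y≢𝟎 = begin
  nonZeroᵇ (x ⊕ y)           ≡⟨ cong nonZeroᵇ x⊕y≡𝟎 ⟩
  nonZeroᵇ (𝟎 {m})           ≡⟨ nonZeroᵇ-𝟎 {m} ⟩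
  true xor true              ≡⟨ cong₂ _xor_ (nonZeroᵇ-≢𝟎 x≢𝟎) (nonZeroᵇ-≢𝟎 y≢𝟎) ⟨
  nonZeroᵇ x xor nonZeroᵇ y  ∎
  where
  x⊕y≡𝟎 : x ⊕ y ≡ 𝟎
  x⊕y≡𝟎 = decidable-stable ((x ⊕ y) ≟𝟎) λ x⊕y≢𝟎 → free x y (x≢𝟎 , y≢𝟎 , x⊕y≢𝟎) mono

𝟎++𝟎 : ∀ d {e} → 𝟎 {d} ++ 𝟎 {e} ≡ 𝟎
𝟎++𝟎 ℕ.zero    = refl
𝟎++𝟎 (ℕ.suc d) = cong (false ∷_) (𝟎++𝟎 d)

take-drop-𝟎 : ∀ d {e} (v : F₂^ (d + e)) → take d v ≡ 𝟎 → drop d v ≡ 𝟎 → v ≡ 𝟎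
take-drop-𝟎 d {e} v take≡𝟎 drop≡𝟎 = begin
  v                    ≡⟨ take++drop≡id d v ⟨
  take d v ++ drop d v ≡⟨ cong₂ _++_ take≡𝟎 drop≡𝟎 ⟩
  𝟎 {d} ++ 𝟎 {e}       ≡⟨ 𝟎++𝟎 d ⟩
  𝟎                    ∎

take-⊕ : ∀ d {e} (v u : F₂^ (d + e)) → take d (v ⊕ u) ≡ take d v ⊕ take d u
take-⊕ d = take-zipWith _xor_

drop-⊕ : ∀ d {e} (v u : F₂^ (d + e)) → drop d (v ⊕ u) ≡ drop d v ⊕ drop d u
drop-⊕ d = drop-zipWith _xor_

collapse : ∀ d {e} → F₂^ (d + e) → F₂^ (ℕ.suc e)
collapse d v = nonZeroᵇ (take d v) ∷ drop d v

collapse-nonZero : ∀ d {e} {v : F₂^ (d + e)} → NonZero₂ v → NonZero₂ (collapse d v)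
collapse-nonZero d {v = v} v≢𝟎 collapse≡𝟎 with toSum (take d v ≟𝟎)
... | inj₁ take≡𝟎 = v≢𝟎 (take-drop-𝟎 d v take≡𝟎 (cong tail collapse≡𝟎))
... | inj₂ take≢𝟎 with () ← trans (sym (nonZeroᵇ-≢𝟎 take≢𝟎)) (cong head collapse≡𝟎)

collapse-⊕ : ∀ d {e} {v u : F₂^ (d + e)} {col : F₂^ d → A} →
             LineFree col → Monochromatic col (take d v) (take d u) →
             collapse d (v ⊕ u) ≡ collapse d v ⊕ collapse d u
collapse-⊕ d {e} {v} {u} free mono = cong₂ _∷_
  (trans (cong nonZeroᵇ (take-⊕ d {e} v u)) (nonZeroᵇ-⊕ free mono))
  (drop-⊕ d {e} v u)

combine : Fin (ℕ.suc b) → Fin c → Fin b ⊎ Fin c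
combine zero    j = inj₂ j
combine (suc i) j = inj₁ i

combine-monochromatic : ∀ {i₁ i₂ i₃ : Fin (ℕ.suc b)} {j₁ j₂ j₃ : Fin c} →
  combine i₁ j₁ ≡ combine i₂ j₂ → combine i₂ j₂ ≡ combine i₃ j₃ →
  i₁ ≡ i₂ × i₂ ≡ i₃ × (i₁ ≢ zero ⊎ j₁ ≡ j₂ × j₂ ≡ j₃)
combine-monochromatic {i₁ = zero}  {zero}  {zero}  refl refl = refl , refl , inj₂ (refl , refl)
combine-monochromatic {i₁ = suc _} {suc _} {suc _} refl refl = refl , refl , inj₁ λ ()
combine-monochromatic {i₁ = zero}  {suc _} ()
combine-monochromatic {i₁ = suc _} {zero}  ()
combine-monochromatic {i₂ = zero}  {suc _} _ ()
combine-monochromatic {i₂ = suc _} {zero}  _ ()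

module Glue {d e} {f : F₂^ d → Fin (ℕ.suc b)} {g : F₂^ (ℕ.suc e) → Fin c}
            (f-lineFree : LineFree f) (f-𝟎 : f 𝟎 ≡ zero) (g-lineFree : LineFree g) where

  glued : F₂^ (d + e) → Fin b ⊎ Fin c
  glued v = combine (f (take d v)) (g (collapse d v))

  take-monochromatic : ∀ {v u} → f (take d v) ≡ f (take d u) → f (take d u) ≡ f (take d (v ⊕ u)) →
                       Monochromatic f (take d v) (take d u)
  take-monochromatic {v} {u} e₁ e₂ = e₁ , trans e₂ (cong f (take-⊕ d {e} v u))

  ≢𝟎-of-colour : ∀ {x} → f x ≢ zero → NonZero₂ x
  ≢𝟎-of-colour fx≢zero refl = fx≢zero f-𝟎

  glued-lineFree : LineFree glued
  glued-lineFree v u (v≢𝟎 , u≢𝟎 , v⊕u≢𝟎) (e₁ , e₂) with combine-monochromatic e₁ e₂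
  ... | f₁ , f₂ , inj₁ fv≢zero =
    f-lineFree (take d v) (take d u)
      ( ≢𝟎-of-colour fv≢zero
      , ≢𝟎-of-colour (fv≢zero ∘ trans f₁)
      , subst NonZero₂ (take-⊕ d {e} v u) (≢𝟎-of-colour (fv≢zero ∘ trans (trans f₁ f₂))) )
      (take-monochromatic f₁ f₂)
  ... | f₁ , f₂ , inj₂ (g₁ , g₂) =
    g-lineFree (collapse d v) (collapse d u)
      ( collapse-nonZero d v≢𝟎
      , collapse-nonZero d u≢𝟎
      , subst NonZero₂ collapse-additive (collapse-nonZero d v⊕u≢𝟎) )
      (g₁ , trans g₂ (cong g collapse-additive))
    where
    collapse-additive : collapse d (v ⊕ u) ≡ collapse d v ⊕ collapse d u
    collapse-additive = collapse-⊕ d {e} f-lineFree (take-monochromatic f₁ f₂)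

colorable-+ : ∀ {d e} → Colorable d (ℕ.suc b) → Colorable (ℕ.suc e) c → Colorable (d + e) (b + c)
colorable-+ {b} {c} colorable-f (g , g-proper)
  with f , f-lineFree , f-𝟎 ← colorable⇒lineFree-with-𝟎 colorable-f zero =
  join b c ∘ glued , lineFree⇒proper (lineFree-∘ join-injective glued-lineFree)
  where
  open Glue f-lineFree f-𝟎 (proper⇒lineFree g-proper)

  join-injective : ∀ {s t} → join b c s ≡ join b c t → s ≡ t
  join-injective {s} {t} eq = begin
    s                       ≡⟨ splitAt-join b c s ⟨
    splitAt b (join b c s)  ≡⟨ cong (splitAt b) eq ⟩
    splitAt b (join b c t)  ≡⟨ splitAt-join b c t ⟩
    t                       ∎

lemma3p1 : ∀ (n d : ℕ) → 1 ≤ d → d < n →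
           ∀ (a b c : ℕ) → IsChi₂ n a → IsChi₂ d b → IsChi₂ ((n + 1) ∸ d) c →
           a + 1 ≤ b + c
lemma3p1 n d _ d<n a ℕ.zero c _ (colorable-d , _) _ = ⊥-elim (¬colorable-0 colorable-d)
lemma3p1 n d _ d<n a (ℕ.suc b) c (_ , a-least) (colorable-d , _) (colorable-e , _) =
  subst (a + 1 ≤_) (+-comm (b + c) 1) (+-monoˡ-≤ 1 (a-least (b + c) colorable-n))
  where
  d≤n : d ≤ n
  d≤n = <⇒≤ d<n

  e-dimension : (n + 1) ∸ d ≡ ℕ.suc (n ∸ d)
  e-dimension = trans (+-∸-comm 1 d≤n) (+-comm (n ∸ d) 1)

  colorable-n : Colorable n (b + c)
  colorable-n = subst (λ m → Colorable m (b + c)) (m+[n∸m]≡n d≤n)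
    (colorable-+ colorable-d (subst (λ m → Colorable m c) e-dimension colorable-e))
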